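{- Let $U$ be a finite-dimensional vector space over $\mathbb F_2$ and $\mathcal C\subseteq U^*\setminus\{0\}$ a set of nonzero linear forms with $\dim_{\mathbb F_2}\langle\mathcal C\rangle\le2$. Let $F=K_4^-\times F^\star$ where $K_4^-=\{abc,abd,acd\}$ and $F^\star=\{123,124,345,156,257\}$. Then there is no homomorphism $F\to R(U,\mathcal C)$. Consequently, every blowup of $R(U,\mathcal C)$ is $F$-free.
   Context: $U^*$ is the dual space of $U$. The cut template $R(U,\mathcal C)$ is the $3$-graph with vertex set $\{a_c:c\in\mathcal C\}\sqcup U$ (apex vertices $a_c$, bottom vertices $U$) whose edges are exactly the triples $\{a_c,u,v\}$ with $c\in\mathcal C$, $u,v\in U$ distinct, and $c(u+v)=1$. The categorical product $G\times H$ of $3$-graphs has vertex set $V(G)\times V(H)$ with $\{(x_1,y_1),(x_2,y_2),(x_3,y_3)\}$ an edge iff $\{x_1,x_2,x_3\}\in G$ and $\{y_1,y_2,y_3\}\in H$. A homomorphism $G_1\to G_2$ of $3$-graphs is a map $V(G_1)\to V(G_2)$ sending every edge to an edge (in particular to a $3$-element set). For a $3$-graph $G$ on $[m]$ and pairwise disjoint sets $V_1,\dots,V_m$, the blowup $G[V_1,\dots,V_m]$ has vertex set $\bigcup V_i$ and edges all triples $\{x,y,z\}$ with $x\in V_i,y\in V_j,z\in V_k$ for some $ijk\in G$. $F$-free means containing no subgraph isomorphic to $F$. -}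

module Defs where

open import Data.Nat using (ℕ)
open import Data.Bool using (Bool; true; false; _∧_; _xor_)
open import Data.Fin using (Fin; zero; suc; #_)
open import Data.Vec using (Vec; zipWith; map)
open import Data.List using (List; []; _∷_)
open import Data.List.Membership.Propositional using (_∈_)
open import Data.Product using (Σ; ∃; _×_; _,_; proj₁; proj₂)
open import Data.Sum using (_⊎_; inj₁; inj₂)
open import Data.Empty using (⊥)
open import Relation.Nullary using (¬_)
open import Relation.Binary.PropositionalEquality using (_≡_; _≢_)
open import Function.Definitions using (Injective)

-- The F₂-vector space U is modelled as F₂ⁿ = Vec Bool n
-- (addition = pointwise xor, scalar multiplication = pointwise ∧).
V : ℕ → Set
V n = Vec Bool n

_⊕_ : ∀ {n} → V n → V n → V n
u ⊕ v = zipWith _xor_ u v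

_·_ : ∀ {n} → Bool → V n → V n
a · u = map (a ∧_) u

IsLinearForm : ∀ {n} → (V n → Bool) → Set
IsLinearForm {n} c =
  (∀ (u v : V n) → c (u ⊕ v) ≡ c u xor c v) × (∀ (a : Bool) (u : V n) → c (a · u) ≡ a ∧ c u)

IsZeroForm : ∀ {n} → (V n → Bool) → Set
IsZeroForm {n} c = ∀ (u : V n) → c u ≡ false

-- 3-uniform hypergraph edge predicates on ordered triples, closed under
-- permutation of the three arguments.
Perm3 : ∀ {A : Set} → (A → A → A → Set) → A → A → A → Set
Perm3 P x y z = P x y z ⊎ P x z y ⊎ P y x z ⊎ P y z x ⊎ P z x y ⊎ P z y x

ListEdge : ∀ {A : Set} → List (A × A × A) → A → A → A → Set
ListEdge L x y z = Σ _ λ t → t ∈ L × Perm3 (λ a b c → (a , b , c) ≡ t) x y z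

-- K₄⁻ = {abc, abd, acd} on a=0,b=1,c=2,d=3
K4⁻ : List (Fin 4 × Fin 4 × Fin 4)
K4⁻ = (# 0 , # 1 , # 2) ∷ (# 0 , # 1 , # 3) ∷ (# 0 , # 2 , # 3) ∷ []

-- F⋆ = {123,124,345,156,257} on vertices 1..7 ↦ 0..6
F⋆ : List (Fin 7 × Fin 7 × Fin 7)
F⋆ = (# 0 , # 1 , # 2) ∷ (# 0 , # 1 , # 3) ∷ (# 2 , # 3 , # 4) ∷ (# 0 , # 4 , # 5) ∷ (# 1 , # 4 , # 6) ∷ []

VF : Set
VF = Fin 4 × Fin 7

FEdge : VF → VF → VF → Set
FEdge p q r = ListEdge K4⁻ (proj₁ p) (proj₁ q) (proj₁ r)
            × ListEdge F⋆ (proj₂ p) (proj₂ q) (proj₂ r)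

-- Cut template R(U, 𝒞), with 𝒞 given as a family cs : Fin k → U*.
-- Vertices: apex a_i (i : Fin k) ⊎ bottom vertices U.
VR : ℕ → ℕ → Set
VR k n = Fin k ⊎ V n

REdge₀ : ∀ {k n} → (Fin k → V n → Bool) → VR k n → VR k n → VR k n → Set
REdge₀ cs (inj₁ i) (inj₂ u) (inj₂ v) = (u ≢ v) × (cs i (u ⊕ v) ≡ true)
REdge₀ cs _ _ _ = ⊥

REdge : ∀ {k n} → (Fin k → V n → Bool) → VR k n → VR k n → VR k n → Set
REdge cs = Perm3 (REdge₀ cs)

IsHomFR : ∀ {k n} → (Fin k → V n → Bool) → (VF → VR k n) → Set
IsHomFR cs f = ∀ p q r → FEdge p q r → REdge cs (f p) (f q) (f r)

-- Blowup of R(U,𝒞): finite vertex set Fin m with part-assignment π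
-- (vertex x lies in part V_{π x}); edges are triples whose parts form an edge of R.
BlowupEdge : ∀ {k n m} → (Fin k → V n → Bool) → (Fin m → VR k n) → Fin m → Fin m → Fin m → Set
BlowupEdge cs π x y z = REdge cs (π x) (π y) (π z)

-- F-free: no subgraph isomorphic to F, i.e. no injective edge-preserving map.
FFreeBlowup : ∀ {k n m} → (Fin k → V n → Bool) → (Fin m → VR k n) → Set
FFreeBlowup cs π =
  ¬ (Σ (VF → Fin _) λ φ → Injective _≡_ _≡_ φ × (∀ p q r → FEdge p q r → BlowupEdge cs π (φ p) (φ q) (φ r)))

DistinctForms : ∀ {k n} → (Fin k → V n → Bool) → Set
DistinctForms {k} {n} cs = ∀ (i j : Fin k) → (∀ (u : V n) → cs i u ≡ cs j u) → i ≡ j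

-- dim ⟨𝒞⟩ ≤ 2 : 𝒞 is contained in the span of two linear forms d₁ d₂
SpanDimLe2 : ∀ {k n} → (Fin k → V n → Bool) → Set
SpanDimLe2 {k} {n} cs =
  Σ (V n → Bool) λ d₁ → Σ (V n → Bool) λ d₂ → IsLinearForm d₁ × IsLinearForm d₂ ×
    (∀ (i : Fin k) → Σ Bool λ a → Σ Bool λ b → ∀ (u : V n) → cs i u ≡ (a ∧ d₁ u) xor (b ∧ d₂ u))

{-# OPTIONS --safe #-}
-- Write each c ∈ 𝒞 as a d₁ + b d₂. Then a_c ↦ (a , b), u ↦ (d₁ u , d₂ u) is a homomorphism from
-- R(U, 𝒞) to the eight-vertex template R(F₂², (F₂²)*), since c (u + v) only depends on the image
-- of u + v. So it suffices that F has no homomorphism into R(F₂², (F₂²)*), which is a finite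
-- check: a backtracking search over the maps of the 28 vertices of F, testing each edge as soon as
-- its three vertices are assigned, finds none. A copy of F in a blowup, composed with the map
-- sending each part to its vertex of R(U, 𝒞), would be such a homomorphism.
module Submission where

open import Defs
open import Data.Nat using (ℕ)
open import Data.Bool using (Bool; true; false; T; _∧_; _xor_)
open import Data.Bool.ListAction using (any; all)
open import Data.Fin using (Fin; #_)
open import Data.Fin.Properties using () renaming (_≟_ to _≟ᶠ_)
open import Data.Product using (Σ; _×_; _,_; proj₁; proj₂)
open import Data.Product.Properties using (≡-dec)
open import Data.Sum using (_⊎_; inj₁; inj₂)
open import Data.List using (List; []; _∷_; _++_; map; concatMap; filter; cartesianProduct)
open import Data.List.Relation.Unary.All as All using (All; []; _∷_; all?)
open import Data.List.Relation.Unary.All.Properties using (all⁻; concat⁺; filter⁺; map⁺)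
open import Data.List.Relation.Unary.Any using (here; there)
open import Data.List.Relation.Unary.Any.Properties using (any⁺)
open import Data.List.Membership.Propositional using (_∈_; lose)
open import Data.List.Membership.Propositional.Properties using (∈-++⁺ˡ; ∈-++⁺ʳ; ∈-map⁺; ∈-cartesianProduct⁺)
import Data.List.Membership.DecPropositional as DecMembership
open import Data.Maybe using (Maybe; just; nothing)
open import Data.Maybe.Relation.Unary.All as Maybe using (just; nothing)
open import Data.Unit using (tt)
open import Function using (_∘_; Equivalence)
open import Relation.Nullary using (¬_; Dec; yes; no)
open import Relation.Nullary.Decidable using (_×-dec_; _⊎-dec_; isYes; fromWitness)
open import Relation.Binary using (DecidableEquality)
open import Relation.Binary.PropositionalEquality using (_≡_; refl; cong₂; subst; module ≡-Reasoning)
import Data.Bool.Properties as Bool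

Rel₃ : Set → Set₁
Rel₃ A = A → A → A → Set

IsHom : {A B : Set} → Rel₃ A → Rel₃ B → (A → B) → Set
IsHom E E′ f = ∀ x y z → E x y z → E′ (f x) (f y) (f z)

∘-isHom : {A B C : Set} {E₁ : Rel₃ A} {E₂ : Rel₃ B} {E₃ : Rel₃ C} {f : A → B} {g : B → C} →
          IsHom E₂ E₃ g → IsHom E₁ E₂ f → IsHom E₁ E₃ (g ∘ f)
∘-isHom g-hom f-hom x y z = g-hom _ _ _ ∘ f-hom x y z

Perm3-isHom : {A B : Set} {P : Rel₃ A} {Q : Rel₃ B} {f : A → B} →
              IsHom P Q f → IsHom (Perm3 P) (Perm3 Q) f
Perm3-isHom h x y z (inj₁ p)                                   = inj₁ (h x y z p)
Perm3-isHom h x y z (inj₂ (inj₁ p))                            = inj₂ (inj₁ (h x z y p))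
Perm3-isHom h x y z (inj₂ (inj₂ (inj₁ p)))                     = inj₂ (inj₂ (inj₁ (h y x z p)))
Perm3-isHom h x y z (inj₂ (inj₂ (inj₂ (inj₁ p))))              = inj₂ (inj₂ (inj₂ (inj₁ (h y z x p))))
Perm3-isHom h x y z (inj₂ (inj₂ (inj₂ (inj₂ (inj₁ p)))))       = inj₂ (inj₂ (inj₂ (inj₂ (inj₁ (h z x y p)))))
Perm3-isHom h x y z (inj₂ (inj₂ (inj₂ (inj₂ (inj₂ p)))))       = inj₂ (inj₂ (inj₂ (inj₂ (inj₂ (h z y x p)))))

Perm3? : {A : Set} {P : Rel₃ A} → (∀ x y z → Dec (P x y z)) → ∀ x y z → Dec (Perm3 P x y z)
Perm3? P? x y z = P? x y z ⊎-dec P? x z y ⊎-dec P? y x z ⊎-dec P? y z x ⊎-dec P? z x y ⊎-dec P? z y x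

perms : {A : Set} → A × A × A → List (A × A × A)
perms (x , y , z) = (x , y , z) ∷ (x , z , y) ∷ (y , x , z) ∷ (y , z , x) ∷ (z , x , y) ∷ (z , y , x) ∷ []

∈-perms⇒Perm3 : {A : Set} {s : A × A × A} {x y z : A} →
                (x , y , z) ∈ perms s → Perm3 (λ a b c → (a , b , c) ≡ s) x y z
∈-perms⇒Perm3 (here refl)                                 = inj₁ refl
∈-perms⇒Perm3 (there (here refl))                         = inj₂ (inj₁ refl)
∈-perms⇒Perm3 (there (there (here refl)))                 = inj₂ (inj₂ (inj₁ refl))
∈-perms⇒Perm3 (there (there (there (here refl))))         = inj₂ (inj₂ (inj₂ (inj₂ (inj₁ refl))))
∈-perms⇒Perm3 (there (there (there (there (here refl))))) = inj₂ (inj₂ (inj₂ (inj₁ refl)))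
∈-perms⇒Perm3 (there (there (there (there (there (here refl)))))) = inj₂ (inj₂ (inj₂ (inj₂ (inj₂ refl))))

zip₃ : {A B : Set} → A × A × A → B × B × B → (A × B) × (A × B) × (A × B)
zip₃ s t = (proj₁ s , proj₁ t) , (proj₁ (proj₂ s) , proj₁ (proj₂ t)) , (proj₂ (proj₂ s) , proj₂ (proj₂ t))

productEdges : {A B : Set} → List (A × A × A) → List (B × B × B) → List ((A × B) × (A × B) × (A × B))
productEdges K L = concatMap (λ s → concatMap (λ t → map (zip₃ s) (perms t)) L) K

ProductEdge : {A B : Set} → List (A × A × A) → List (B × B × B) → Rel₃ (A × B)
ProductEdge K L p q r = ListEdge K (proj₁ p) (proj₁ q) (proj₁ r) × ListEdge L (proj₂ p) (proj₂ q) (proj₂ r)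

productEdges-sound : {A B : Set} (K : List (A × A × A)) (L : List (B × B × B)) →
                     All (λ (p , q , r) → ProductEdge K L p q r) (productEdges K L)
productEdges-sound K L =
  concat⁺ (map⁺ (All.tabulate λ s∈K → concat⁺ (map⁺ (All.tabulate λ t∈L →
    map⁺ (All.tabulate λ σ∈perms → (_ , s∈K , inj₁ refl) , (_ , t∈L , ∈-perms⇒Perm3 σ∈perms))))))

F₂² : Set
F₂² = Bool × Bool

-- R(F₂², (F₂²)*): the apex inj₁ (a , b) stands for the form (x , y) ↦ a x + b y.
-- The condition u ≢ v of REdge₀ is dropped; no form is true on u + u anyway.
R₂ : Set
R₂ = F₂² ⊎ F₂²

cut₂ : R₂ → R₂ → R₂ → Bool
cut₂ (inj₁ (a , b)) (inj₂ (x , y)) (inj₂ (x′ , y′)) = (a ∧ (x xor x′)) xor (b ∧ (y xor y′))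
cut₂ _ _ _ = false

Cut₂ : Rel₃ R₂
Cut₂ x y z = cut₂ x y z ≡ true

R₂Edge : Rel₃ R₂
R₂Edge = Perm3 Cut₂

R₂Edge? : ∀ x y z → Dec (R₂Edge x y z)
R₂Edge? = Perm3? (λ x y z → cut₂ x y z Bool.≟ true)

bools : List Bool
bools = false ∷ true ∷ []

∈-bools : ∀ b → b ∈ bools
∈-bools false = here refl
∈-bools true  = there (here refl)

points : List F₂²
points = cartesianProduct bools bools

verticesR₂ : List R₂
verticesR₂ = map inj₁ points ++ map inj₂ points

∈-verticesR₂ : ∀ v → v ∈ verticesR₂
∈-verticesR₂ (inj₁ (a , b)) = ∈-++⁺ˡ (∈-map⁺ inj₁ (∈-cartesianProduct⁺ (∈-bools a) (∈-bools b)))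
∈-verticesR₂ (inj₂ (x , y)) = ∈-++⁺ʳ (map inj₁ points) (∈-map⁺ inj₂ (∈-cartesianProduct⁺ (∈-bools x) (∈-bools y)))

homToR₂ : ∀ {k n} (cs : Fin k → V n → Bool) → SpanDimLe2 cs → Σ (VR k n → R₂) (IsHom (REdge cs) R₂Edge)
homToR₂ {k} {n} cs (d₁ , d₂ , (d₁-⊕ , _) , (d₂-⊕ , _) , coeffs) =
  collapse , Perm3-isHom {Q = Cut₂} {f = collapse} collapse-edge
  where
  collapse : VR k n → R₂
  collapse (inj₁ i) = inj₁ (proj₁ (coeffs i) , proj₁ (proj₂ (coeffs i)))
  collapse (inj₂ u) = inj₂ (d₁ u , d₂ u)

  collapse-edge : IsHom (REdge₀ cs) Cut₂ collapse
  collapse-edge (inj₁ i) (inj₂ u) (inj₂ v) (_ , c[u⊕v]) with coeffs i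
  ... | a , b , cᵢ≡ = subst (_≡ true) c≡cut c[u⊕v]
    where
    open ≡-Reasoning
    c≡cut : cs i (u ⊕ v) ≡ (a ∧ (d₁ u xor d₁ v)) xor (b ∧ (d₂ u xor d₂ v))
    c≡cut = begin
      cs i (u ⊕ v)                                    ≡⟨ cᵢ≡ (u ⊕ v) ⟩
      (a ∧ d₁ (u ⊕ v)) xor (b ∧ d₂ (u ⊕ v))           ≡⟨ cong₂ (λ p q → (a ∧ p) xor (b ∧ q)) (d₁-⊕ u v) (d₂-⊕ u v) ⟩
      (a ∧ (d₁ u xor d₁ v)) xor (b ∧ (d₂ u xor d₂ v)) ∎

module Backtracking {A B : Set} (_≟_ : DecidableEquality A)
                    (values : List B) (∈-values : ∀ b → b ∈ values)
                    {E : Rel₃ B} (E? : ∀ x y z → Dec (E x y z)) where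

  open DecMembership _≟_ using (_∈?_)

  Triple : Set
  Triple = A × A × A

  Assignment : Set
  Assignment = List (A × B)

  Agrees : (A → B) → Assignment → Set
  Agrees g = All (λ (a , b) → g a ≡ b)

  Holds : (A → B) → Triple → Set
  Holds g (x , y , z) = E (g x) (g y) (g z)

  HoldsOn : (A → B) → List Triple → Set
  HoldsOn g = All (Holds g)

  lookup : Assignment → A → Maybe B
  lookup [] a = nothing
  lookup ((x , b) ∷ ρ) a with x ≟ a
  ... | yes _ = just b
  ... | no _  = lookup ρ a

  lookup-agrees : ∀ {g ρ} → Agrees g ρ → ∀ a → Maybe.All (g a ≡_) (lookup ρ a)
  lookup-agrees [] a = nothing
  lookup-agrees {ρ = (x , b) ∷ _} (gx≡b ∷ agrees) a with x ≟ a
  ... | yes refl = just gx≡b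
  ... | no _     = lookup-agrees agrees a

  testᵐ : Maybe B → Maybe B → Maybe B → Bool
  testᵐ (just x) (just y) (just z) = isYes (E? x y z)
  testᵐ _        _        _        = true

  testᵐ-sound : ∀ {x y z mx my mz} → Maybe.All (x ≡_) mx → Maybe.All (y ≡_) my → Maybe.All (z ≡_) mz →
                E x y z → T (testᵐ mx my mz)
  testᵐ-sound (just refl) (just refl) (just refl) e = fromWitness e
  testᵐ-sound nothing     _           _           _ = tt
  testᵐ-sound (just _)    nothing     _           _ = tt
  testᵐ-sound (just _)    (just _)    nothing     _ = tt

  test : Assignment → Triple → Bool
  test ρ (x , y , z) = testᵐ (lookup ρ x) (lookup ρ y) (lookup ρ z)

  test-sound : ∀ {g ρ} → Agrees g ρ → ∀ t → Holds g t → T (test ρ t)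
  test-sound agrees (x , y , z) = testᵐ-sound (lookup-agrees agrees x) (lookup-agrees agrees y) (lookup-agrees agrees z)

  -- A plan lists the vertices in the order they get assigned, each with the edges to test right after.
  Plan : Set
  Plan = List (A × List Triple)

  extendable : Plan → Assignment → Bool
  extendable []                ρ = true
  extendable ((x , es) ∷ plan) ρ =
    any (λ b → all (test ((x , b) ∷ ρ)) es ∧ extendable plan ((x , b) ∷ ρ)) values

  hom⇒extendable : ∀ {g} plan {ρ} → Agrees g ρ → All (HoldsOn g ∘ proj₂) plan → T (extendable plan ρ)
  hom⇒extendable []                _      _                      = tt
  hom⇒extendable {g} ((x , es) ∷ plan) {ρ} agrees (es-hold ∷ plan-holds) =
    any⁺ _ (lose (∈-values (g x)) (Bool.T-∧ .Equivalence.from (tests-pass , rest-extendable)))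
    where
    agrees′ : Agrees g ((x , g x) ∷ ρ)
    agrees′ = refl ∷ agrees
    tests-pass : T (all (test ((x , g x) ∷ ρ)) es)
    tests-pass = all⁻ _ (All.map (λ {t} → test-sound agrees′ t) es-hold)
    rest-extendable : T (extendable plan ((x , g x) ∷ ρ))
    rest-extendable = hom⇒extendable plan agrees′ plan-holds

  vertices : Triple → List A
  vertices (x , y , z) = x ∷ y ∷ z ∷ []

  planAfter : List A → List A → List Triple → Plan
  planAfter assigned []       es = []
  planAfter assigned (x ∷ xs) es =
    (x , filter (λ e → x ∈? vertices e ×-dec all? (_∈? x ∷ assigned) (vertices e)) es)
    ∷ planAfter (x ∷ assigned) xs es

  planAfter-holds : ∀ {g} assigned order {es} → HoldsOn g es → All (HoldsOn g ∘ proj₂) (planAfter assigned order es)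
  planAfter-holds assigned []       holds = []
  planAfter-holds assigned (x ∷ xs) holds = filter⁺ _ holds ∷ planAfter-holds (x ∷ assigned) xs holds

  ¬extendable⇒¬hom : ∀ order es → extendable (planAfter [] order es) [] ≡ false → ∀ g → ¬ HoldsOn g es
  ¬extendable⇒¬hom order es fails g holds =
    subst T fails (hom⇒extendable (planAfter [] order es) [] (planAfter-holds [] order holds))

_≟VF_ : DecidableEquality VF
_≟VF_ = ≡-dec _≟ᶠ_ _≟ᶠ_

open Backtracking _≟VF_ verticesR₂ ∈-verticesR₂ R₂Edge? using (HoldsOn; planAfter; extendable; ¬extendable⇒¬hom)

edgesF : List (VF × VF × VF)
edgesF = productEdges K4⁻ F⋆

-- Found by a local search over orderings; it keeps the search tree at about 24 000 nodes.
searchOrder : List VF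
searchOrder = (# 0 , # 0) ∷ (# 3 , # 1) ∷ (# 2 , # 3) ∷ (# 1 , # 2) ∷ (# 0 , # 4) ∷ (# 1 , # 6) ∷ (# 2 , # 1) ∷
              (# 3 , # 2) ∷ (# 0 , # 1) ∷ (# 1 , # 0) ∷ (# 2 , # 5) ∷ (# 3 , # 4) ∷ (# 0 , # 2) ∷ (# 0 , # 3) ∷
              (# 0 , # 5) ∷ (# 0 , # 6) ∷ (# 3 , # 6) ∷ (# 1 , # 5) ∷ (# 3 , # 5) ∷ (# 1 , # 3) ∷ (# 2 , # 2) ∷
              (# 2 , # 4) ∷ (# 3 , # 3) ∷ (# 2 , # 0) ∷ (# 1 , # 4) ∷ (# 1 , # 1) ∷ (# 3 , # 0) ∷ (# 2 , # 6) ∷ []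

search-fails : extendable (planAfter [] searchOrder edgesF) [] ≡ false
search-fails = refl

¬homF→R₂ : (g : VF → R₂) → ¬ IsHom FEdge R₂Edge g
¬homF→R₂ g g-hom = ¬extendable⇒¬hom searchOrder edgesF search-fails g edgesF-hold
  where
  edgesF-hold : HoldsOn g edgesF
  edgesF-hold = All.map (λ {(p , q , r)} → g-hom p q r) (productEdges-sound K4⁻ F⋆)

¬homF→R : ∀ {k n} {cs : Fin k → V n → Bool} → SpanDimLe2 cs → ¬ Σ (VF → VR k n) (IsHomFR cs)
¬homF→R {cs = cs} span (f , f-hom) with homToR₂ cs span
... | collapse , collapse-hom = ¬homF→R₂ (collapse ∘ f) (∘-isHom {E₃ = R₂Edge} {g = collapse} collapse-hom f-hom)

¬hom⇒blowup-FFree : ∀ {k n} {cs : Fin k → V n → Bool} → ¬ Σ (VF → VR k n) (IsHomFR cs) →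
                     ∀ m (π : Fin m → VR k n) → FFreeBlowup cs π
¬hom⇒blowup-FFree ¬hom m π (φ , _ , φ-hom) = ¬hom (π ∘ φ , φ-hom)

proposition4p3 : (n k : ℕ) (cs : Fin k → V n → Bool)
    → (∀ i → IsLinearForm (cs i))
    → (∀ i → ¬ IsZeroForm (cs i))
    → DistinctForms cs
    → SpanDimLe2 cs
    → (¬ Σ (VF → VR k n) (IsHomFR cs))
      × (∀ (m : ℕ) (π : Fin m → VR k n) → FFreeBlowup cs π)
proposition4p3 n k cs _ _ _ span = ¬hom , ¬hom⇒blowup-FFree ¬hom
  where
  ¬hom : ¬ Σ (VF → VR k n) (IsHomFR cs)
  ¬hom = ¬homF→R span
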